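{- Fix an integer $k\geq 4$. Then, as $r\to\infty$ (over integers $r\geq 2$), \[ w_r(k)\geq \left(\frac{3-e}{2}\right)\frac{(r(k-2))!}{((k-2)!)^r}\left(1-o_{r\to\infty}(1)\right). \]
   Context: For each integer $r\geq 2$, $w_r:\mathbb{Z}_{\geq 2}^r\to\mathbb{Z}_{\geq 0}$ denotes the family of functions uniquely determined by: (i) $w_2(k_1,k_2)=0$ for $k_1,k_2\geq 2$; (ii) for $r\geq 2$ and $k_1,\dots,k_r\geq 2$, inserting a coordinate equal to $2$ at any position of $(k_1,\dots,k_r)$ gives an $(r+1)$-tuple at which $w_{r+1}$ equals $w_r(k_1,\dots,k_r)$; (iii) for $k_1,\dots,k_r\geq 3$, $w_r(k_1,\dots,k_r)=\sum_{i=1}^r w_r(k_1,\dots,k_i-1,\dots,k_r)+(r-2)$ (the $i$-th coordinate decreased by $1$). $w_r(k)$ means $w_r(k,\dots,k)$. $o_{r\to\infty}(1)$ denotes a quantity tending to $0$ as $r\to\infty$. -}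

module Defs where

open import Data.Nat using (ℕ; zero; suc; _+_; _*_; _∸_; _^_; _!; _≤ᵇ_)
open import Data.Bool using (if_then_else_)
open import Data.List using (List; []; _∷_; length; map; replicate)
open import Data.Nat.ListAction using (sum)
open import Data.Product using (Σ; _×_)
open import Data.Nat using (_≤_)
import Data.Rational as Q
open import Data.Integer using (+_)
open import Data.Rational using (ℚ; _/_)

strip : List ℕ → List ℕ
strip []       = []
strip (x ∷ xs) = if x ≤ᵇ 2 then strip xs else x ∷ strip xs

decs : List ℕ → List (List ℕ)
decs []       = []
decs (x ∷ xs) = ((x ∸ 1) ∷ xs) ∷ map (x ∷_) (decs xs)

-- By (ii), w of a tuple equals w of the tuple with its 2's removed
-- (if at most one coordinate is ≥ 3 this reduces, by (i)+(ii), to 0);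
-- on a tuple of s ≥ 2 coordinates all ≥ 3, rule (iii) applies with
-- constant s - 2.  Each recursive step lowers the coordinate sum, so
-- fuel = coordinate sum suffices.
wFuel : ℕ → List ℕ → ℕ
wFuel zero    _ = 0
wFuel (suc f) l with strip l
... | []          = 0
... | _ ∷ []      = 0
... | s@(_ ∷ _ ∷ _) = sum (map (wFuel f) (decs s)) + (length s ∸ 2)

w : List ℕ → ℕ
w l = wFuel (sum l) l

wDiag : ℕ → ℕ → ℕ
wDiag r k = w (replicate r k)

ℕ→ℚ : ℕ → ℚ
ℕ→ℚ n = (+ n) / 1

-- S n = Σ_{i=0}^{n} n!/i!
eS : ℕ → ℕ
eS zero    = 1
eS (suc n) = suc n * eS n + 1

-- u n = eNum n / eDen n = Σ_{i=0}^{n} 1/i! + 1/(n·n!)  (for n ≥ 1);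
-- u is strictly decreasing with limit e, and e < u n for all n ≥ 1.
eNum : ℕ → ℕ
eNum n = n * eS n + 1

eDen : ℕ → ℕ
eDen n = n * (n !)

-- "q < (3 - e)/2", expressed with rationals only:
-- there is n ≥ 1 with q ≤ (3 - u n)/2, i.e. 2·q·eDen n ≤ 3·eDen n - eNum n.
BelowConst : ℚ → Set
BelowConst q = Σ ℕ (λ n → (1 ≤ n) ×
  ((ℕ→ℚ 2 Q.* q) Q.* ℕ→ℚ (eDen n) Q.≤ ℕ→ℚ (3 * eDen n) Q.- ℕ→ℚ (eNum n)))

{-# OPTIONS --safe #-}
module Submission where

open import Defs
open import Data.Nat
open import Data.Nat.Properties
open import Data.Nat.Combinatorics.Base using (_P′_)
open import Data.Nat.Combinatorics.Specification using (nP′k≡n!/[n∸k]!; nP′k≡n[n∸1P′k∸1])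
open import Data.Nat.DivMod using (m/n*n≡m)
open import Data.Nat.Divisibility using (m≤n⇒m!∣n!)
open import Data.Nat.ListAction using (sum; product)
open import Data.Nat.Tactic.RingSolver using (solve-∀)
open import Data.List.Base using (List; []; _∷_; map; length; replicate)
open import Data.List.Properties using (map-∘; length-map; map-replicate)
open import Data.List.Relation.Unary.All using (All; []; _∷_)
open import Data.Product using (Σ; _,_)
open import Data.Sum using (inj₁; inj₂)
open import Relation.Binary.PropositionalEquality
open import Relation.Binary.Definitions using (tri<; tri≈; tri>)
open import Relation.Nullary using (yes; no; contradiction)
import Data.Integer as ℤ
import Data.Integer.Properties as ℤₚ
open import Data.Nat.Coprimality using (1-coprimeTo) renaming (sym to coprime-sym)
open import Data.Rational as ℚ using (ℚ; mkℚ)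
import Data.Rational.Properties as ℚₚ
open import Data.Rational.Solver using (module +-*-Solver)

-- Write d = (k₁ − 2, …, k_r − 2), |d| = Σ dᵢ and eₘ for the elementary symmetric
-- polynomials.  By Euler's identity Σᵢ dᵢ eₘ(d − δᵢ) = (|d| − m) eₘ(d), each
-- (|d| − m)! eₘ(d) with m < |d| is "harmonic" for d ↦ Σᵢ dᵢ F(d − δᵢ), while the top
-- term e_{|d|}(d) is 0 or 1 and is 1 only when |d| ≤ r.  Hence
-- L(d) = Σₘ (m − 2)⁺ (|d| − m)! eₘ(d) satisfies L(d) ≤ Σᵢ dᵢ L(d − δᵢ) + (r − 2), and
-- comparing with recursion (iii) gives Πᵢ dᵢ! · w_r(k) ≥ L(d).  On the diagonal
-- d = (n, …, n), m! eₘ(d) = nᵐ r(r − 1)⋯(r − m + 1) ≥ nᵐ rᵐ / 2 once 2m² ≤ r, so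
-- L(d) ≥ (rn)!/2 · Σ_{m ≤ M} (m − 2)⁺/m!, and Σₘ (m − 2)⁺/m! = 3 − e.

decSum : (List ℕ → ℕ) → List ℕ → ℕ
decSum F []       = 0
decSum F (x ∷ xs) = x * F ((x ∸ 1) ∷ xs) + decSum (λ t → F (x ∷ t)) xs

decSum-cong : ∀ {F G} d → (∀ t → F t ≡ G t) → decSum F d ≡ decSum G d
decSum-cong []       F≗G = refl
decSum-cong (x ∷ xs) F≗G =
  cong₂ (λ a b → x * a + b) (F≗G ((x ∸ 1) ∷ xs)) (decSum-cong xs (λ t → F≗G (x ∷ t)))

decSum-+ : ∀ F G d → decSum (λ t → F t + G t) d ≡ decSum F d + decSum G d
decSum-+ F G []       = refl
decSum-+ F G (x ∷ xs) =
  trans (cong (x * (F d′ + G d′) +_) (decSum-+ (λ t → F (x ∷ t)) (λ t → G (x ∷ t)) xs))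
        (shuffle x (F d′) (G d′) _ _)
  where
  d′ = (x ∸ 1) ∷ xs
  shuffle : ∀ x a b u v → x * (a + b) + (u + v) ≡ (x * a + u) + (x * b + v)
  shuffle = solve-∀

decSum-*ˡ : ∀ a F d → decSum (λ t → a * F t) d ≡ a * decSum F d
decSum-*ˡ a F []       = sym (*-zeroʳ a)
decSum-*ˡ a F (x ∷ xs) =
  trans (cong (x * (a * F d′) +_) (decSum-*ˡ a (λ t → F (x ∷ t)) xs))
        (shuffle x a (F d′) _)
  where
  d′ = (x ∸ 1) ∷ xs
  shuffle : ∀ x a f u → x * (a * f) + a * u ≡ a * (x * f + u)
  shuffle = solve-∀

decSum-const : ∀ c d → decSum (λ _ → c) d ≡ sum d * c
decSum-const c []       = refl
decSum-const c (x ∷ xs) =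
  trans (cong (x * c +_) (decSum-const c xs)) (sym (*-distribʳ-+ c x (sum xs)))

-- Every d − δᵢ with dᵢ ≠ 0 has coordinate sum |d| − 1.  The offset c is needed for the
-- induction: for a head x ≥ 1, x + |xs| ∸ 1 is not x + (|xs| ∸ 1) when |xs| = 0.
decSum-factorˡ : ∀ (g : ℕ → ℕ) F d c →
  decSum (λ t → g (c + sum t) * F t) d ≡ g (c + sum d ∸ 1) * decSum F d
decSum-factorˡ g F []             c = sym (*-zeroʳ (g (c + 0 ∸ 1)))
decSum-factorˡ g F (zero ∷ xs)    c = decSum-factorˡ g (λ t → F (zero ∷ t)) xs c
decSum-factorˡ g F (suc y ∷ xs)   c = begin
  suc y * (g s * f) + decSum (λ t → g (c + (suc y + sum t)) * F′ t) xs
    ≡⟨ cong (suc y * (g s * f) +_) tail ⟩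
  suc y * (g s * f) + g s * decSum F′ xs
    ≡⟨ factor (suc y) (g s) f (decSum F′ xs) ⟩
  g s * (suc y * f + decSum F′ xs)
    ≡⟨ cong (λ n → g n * (suc y * f + decSum F′ xs)) (cong (_∸ 1) (+-suc c (y + sum xs))) ⟨
  g (c + (suc y + sum xs) ∸ 1) * (suc y * f + decSum F′ xs) ∎
  where
  open ≡-Reasoning
  s  = c + (y + sum xs)
  f  = F (y ∷ xs)
  F′ = λ t → F (suc y ∷ t)
  factor : ∀ a b f u → a * (b * f) + b * u ≡ b * (a * f + u)
  factor = solve-∀
  tail : decSum (λ t → g (c + (suc y + sum t)) * F′ t) xs ≡ g s * decSum F′ xs
  tail = begin
    decSum (λ t → g (c + (suc y + sum t)) * F′ t) xs
      ≡⟨ decSum-cong xs (λ t → cong (λ n → g n * F′ t) (+-assoc c (suc y) (sum t))) ⟨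
    decSum (λ t → g (c + suc y + sum t) * F′ t) xs
      ≡⟨ decSum-factorˡ g F′ xs (c + suc y) ⟩
    g (c + suc y + sum xs ∸ 1) * decSum F′ xs
      ≡⟨ cong (λ n → g (n ∸ 1) * decSum F′ xs) (trans (+-assoc c (suc y) (sum xs)) (+-suc c (y + sum xs))) ⟩
    g s * decSum F′ xs ∎

elemSym : ℕ → List ℕ → ℕ
elemSym zero    _        = 1
elemSym (suc m) []       = 0
elemSym (suc m) (x ∷ xs) = x * elemSym m xs + elemSym (suc m) xs

elemSym-0∷ : ∀ m t → elemSym m (0 ∷ t) ≡ elemSym m t
elemSym-0∷ zero    t = refl
elemSym-0∷ (suc m) t = refl

elemSym-vanish : ∀ m d → sum d < m → elemSym m d ≡ 0
elemSym-vanish (suc m) []           _ = refl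
elemSym-vanish (suc m) (zero ∷ xs)  S<m = elemSym-vanish (suc m) xs S<m
elemSym-vanish (suc m) (suc x ∷ xs) (s≤s x+S<m) =
  trans (cong₂ (λ a b → suc x * a + b) (elemSym-vanish m xs S<m) (elemSym-vanish (suc m) xs (m<n⇒m<1+n S<m)))
        (trans (+-identityʳ _) (*-zeroʳ (suc x)))
  where
  S<m : sum xs < m
  S<m = ≤-trans (s≤s (m≤n+m (sum xs) x)) x+S<m

elemSym-≤1 : ∀ m d → sum d ≤ m → elemSym m d ≤ 1
elemSym-≤1 zero    d                  _         = ≤-refl
elemSym-≤1 (suc m) []                 _         = z≤n
elemSym-≤1 (suc m) (zero ∷ xs)        S≤m       = elemSym-≤1 (suc m) xs S≤m
elemSym-≤1 (suc m) (1 ∷ xs)           (s≤s S≤m)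
  rewrite elemSym-vanish (suc m) xs (s≤s S≤m) | +-identityʳ (elemSym m xs) | +-identityʳ (elemSym m xs) =
  elemSym-≤1 m xs S≤m
elemSym-≤1 (suc m) (suc (suc x) ∷ xs) (s≤s x+S<m)
  rewrite elemSym-vanish m xs (≤-trans (s≤s (m≤n+m (sum xs) x)) x+S<m)
        | elemSym-vanish (suc m) xs (s≤s (≤-trans (m≤n+m (sum xs) (suc x)) x+S<m))
        | *-zeroʳ x = z≤n

elemSym*m≤length : ∀ m d → sum d ≤ m → elemSym m d * m ≤ length d
elemSym*m≤length zero    d                  _         = z≤n
elemSym*m≤length (suc m) []                 _         = z≤n
elemSym*m≤length (suc m) (zero ∷ xs)        S≤m       = m≤n⇒m≤1+n (elemSym*m≤length (suc m) xs S≤m)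
elemSym*m≤length (suc m) (1 ∷ xs)           (s≤s S≤m)
  rewrite elemSym-vanish (suc m) xs (s≤s S≤m) | +-identityʳ (elemSym m xs) | +-identityʳ (elemSym m xs)
        | *-suc (elemSym m xs) m =
  +-mono-≤ (elemSym-≤1 m xs S≤m) (elemSym*m≤length m xs S≤m)
elemSym*m≤length (suc m) (suc (suc x) ∷ xs) (s≤s x+S<m)
  rewrite elemSym-vanish m xs (≤-trans (s≤s (m≤n+m (sum xs) x)) x+S<m)
        | elemSym-vanish (suc m) xs (s≤s (≤-trans (m≤n+m (sum xs) (suc x)) x+S<m))
        | *-zeroʳ x = z≤n

elemSym-top-bonus : ∀ d → (sum d ∸ 2) * elemSym (sum d) d ≤ length d ∸ 2
elemSym-top-bonus d
  with elemSym (sum d) d | elemSym-≤1 (sum d) d ≤-refl | elemSym*m≤length (sum d) d ≤-refl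
... | 0           | _       | _       = ≤-trans (≤-reflexive (*-zeroʳ (sum d ∸ 2))) z≤n
... | 1           | _       | S≤len   =
  ≤-trans (≤-reflexive (*-identityʳ (sum d ∸ 2))) (∸-monoˡ-≤ 2 (≤-trans (≤-reflexive (sym (+-identityʳ (sum d)))) S≤len))
... | suc (suc _) | s≤s () | _

elemSym-euler : ∀ m d → decSum (elemSym m) d + m * elemSym m d ≡ sum d * elemSym m d
elemSym-euler zero    d            = trans (+-identityʳ _) (decSum-const 1 d)
elemSym-euler (suc m) []           = *-zeroʳ m
elemSym-euler (suc m) (zero ∷ xs)  = elemSym-euler (suc m) xs
elemSym-euler (suc m) (suc y ∷ xs) = begin
  x * (y * A + B) + decSum (λ t → x * elemSym m t + elemSym (suc m) t) xs + suc m * (x * A + B)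
    ≡⟨ cong (λ u → x * (y * A + B) + u + suc m * (x * A + B)) split ⟩
  x * (y * A + B) + (x * A′ + B′) + suc m * (x * A + B)
    ≡⟨ regroup y m A B A′ B′ ⟩
  x * (y * A + B) + x * A + x * (A′ + m * A) + (B′ + suc m * B)
    ≡⟨ cong₂ (λ u v → x * (y * A + B) + x * A + x * u + v) (elemSym-euler m xs) (elemSym-euler (suc m) xs) ⟩
  x * (y * A + B) + x * A + x * (S * A) + S * B
    ≡⟨ collect y A B S ⟩
  (x + S) * (x * A + B) ∎
  where
  open ≡-Reasoning
  x  = suc y
  S  = sum xs
  A  = elemSym m xs
  B  = elemSym (suc m) xs
  A′ = decSum (elemSym m) xs
  B′ = decSum (elemSym (suc m)) xs
  split : decSum (λ t → x * elemSym m t + elemSym (suc m) t) xs ≡ x * A′ + B′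
  split = trans (decSum-+ (λ t → x * elemSym m t) (elemSym (suc m)) xs) (cong (_+ B′) (decSum-*ˡ x (elemSym m) xs))
  regroup : ∀ y m A B A′ B′ → suc y * (y * A + B) + (suc y * A′ + B′) + suc m * (suc y * A + B)
          ≡ suc y * (y * A + B) + suc y * A + suc y * (A′ + m * A) + (B′ + suc m * B)
  regroup = solve-∀
  collect : ∀ y A B S → suc y * (y * A + B) + suc y * A + suc y * (S * A) + S * B ≡ (suc y + S) * (suc y * A + B)
  collect = solve-∀

term : ℕ → List ℕ → ℕ
term m d = (sum d ∸ m) ! * elemSym m d

term-top : ∀ d → term (sum d) d ≡ elemSym (sum d) d
term-top d rewrite n∸n≡0 (sum d) = +-identityʳ _

term-harmonic : ∀ m d → m < sum d → term m d ≡ decSum (term m) d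
term-harmonic m d m<D = begin
  (D ∸ m) ! * E            ≡⟨ cong (λ n → n ! * E) D∸m≡1+j ⟩
  (suc j) ! * E            ≡⟨ unfold! j (j !) E ⟩
  j ! * (suc j * E)        ≡⟨ cong₂ (λ n u → n ! * u) (∸-+-assoc D 1 m) W≡[1+j]E ⟨
  (D ∸ 1 ∸ m) ! * W        ≡⟨ decSum-factorˡ (λ n → (n ∸ m) !) (elemSym m) d 0 ⟨
  decSum (term m) d        ∎
  where
  open ≡-Reasoning
  D = sum d
  E = elemSym m d
  W = decSum (elemSym m) d
  j = D ∸ suc m
  D∸m≡1+j : D ∸ m ≡ suc j
  D∸m≡1+j = +-∸-assoc 1 m<D
  unfold! : ∀ j f E → (f + j * f) * E ≡ f * (E + j * E)
  unfold! = solve-∀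
  W≡[1+j]E : W ≡ suc j * E
  W≡[1+j]E = +-cancelʳ-≡ (m * E) W (suc j * E) (begin
    W + m * E             ≡⟨ elemSym-euler m d ⟩
    D * E                 ≡⟨ cong (_* E) (m+[n∸m]≡n (<⇒≤ m<D)) ⟨
    (m + (D ∸ m)) * E     ≡⟨ cong (λ n → (m + n) * E) D∸m≡1+j ⟩
    (m + suc j) * E       ≡⟨ cong (_* E) (+-comm m (suc j)) ⟩
    (suc j + m) * E       ≡⟨ *-distribʳ-+ E (suc j) m ⟩
    suc j * E + m * E     ∎)

term-≤-decSum : ∀ m d → m ≢ sum d → term m d ≤ decSum (term m) d
term-≤-decSum m d m≢D with <-cmp m (sum d)
... | tri< m<D _ _ = ≤-reflexive (term-harmonic m d m<D)
... | tri≈ _ m≡D _ = contradiction m≡D m≢D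
... | tri> _ _ m>D rewrite elemSym-vanish m d m>D | *-zeroʳ ((sum d ∸ m) !) = z≤n

lowerSum : ℕ → List ℕ → ℕ
lowerSum zero    d = 0
lowerSum (suc M) d = lowerSum M d + (M ∸ 2) * term M d

decSum-lowerSum : ∀ M d → decSum (lowerSum (suc M)) d ≡ decSum (lowerSum M) d + (M ∸ 2) * decSum (term M) d
decSum-lowerSum M d = trans (decSum-+ (lowerSum M) (λ t → (M ∸ 2) * term M t) d)
                            (cong (decSum (lowerSum M) d +_) (decSum-*ˡ (M ∸ 2) (term M) d))

M≤sum⇒lowerSum≤decSum : ∀ M d → M ≤ sum d → lowerSum M d ≤ decSum (lowerSum M) d
M≤sum⇒lowerSum≤decSum zero    d _   = z≤n
M≤sum⇒lowerSum≤decSum (suc M) d M<D = begin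
  lowerSum M d + (M ∸ 2) * term M d
    ≤⟨ +-mono-≤ (M≤sum⇒lowerSum≤decSum M d (<⇒≤ M<D)) (*-monoʳ-≤ (M ∸ 2) (term-≤-decSum M d (<⇒≢ M<D))) ⟩
  decSum (lowerSum M) d + (M ∸ 2) * decSum (term M) d
    ≡⟨ decSum-lowerSum M d ⟨
  decSum (lowerSum (suc M)) d ∎
  where open ≤-Reasoning

lowerSum-≤-decSum : ∀ M d → lowerSum M d ≤ decSum (lowerSum M) d + (length d ∸ 2)
lowerSum-≤-decSum zero    d = z≤n
lowerSum-≤-decSum (suc M) d with M ≟ sum d
... | no M≢D = begin
  lowerSum M d + (M ∸ 2) * term M d
    ≤⟨ +-mono-≤ (lowerSum-≤-decSum M d) (*-monoʳ-≤ (M ∸ 2) (term-≤-decSum M d M≢D)) ⟩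
  decSum (lowerSum M) d + b + (M ∸ 2) * decSum (term M) d
    ≡⟨ swap-last (decSum (lowerSum M) d) b _ ⟩
  decSum (lowerSum M) d + (M ∸ 2) * decSum (term M) d + b
    ≡⟨ cong (_+ b) (decSum-lowerSum M d) ⟨
  decSum (lowerSum (suc M)) d + b ∎
  where
  open ≤-Reasoning
  b = length d ∸ 2
  swap-last : ∀ a b c → a + b + c ≡ a + c + b
  swap-last = solve-∀
... | yes refl = begin
  lowerSum (sum d) d + (sum d ∸ 2) * term (sum d) d
    ≤⟨ +-mono-≤ (M≤sum⇒lowerSum≤decSum (sum d) d ≤-refl)
                (≤-trans (≤-reflexive (cong ((sum d ∸ 2) *_) (term-top d))) (elemSym-top-bonus d)) ⟩
  decSum (lowerSum (sum d)) d + (length d ∸ 2)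
    ≤⟨ +-monoˡ-≤ (length d ∸ 2) (m≤m+n _ _) ⟩
  decSum (lowerSum (sum d)) d + (sum d ∸ 2) * decSum (term (sum d)) d + (length d ∸ 2)
    ≡⟨ cong (_+ (length d ∸ 2)) (decSum-lowerSum (sum d) d) ⟨
  decSum (lowerSum (suc (sum d))) d + (length d ∸ 2) ∎
  where open ≤-Reasoning

lowerSum-vanish : ∀ M t → (∀ m → elemSym (2 + m) t ≡ 0) → lowerSum M t ≡ 0
lowerSum-vanish zero                t _ = refl
lowerSum-vanish (suc zero)          t _ = refl
lowerSum-vanish (suc (suc zero))    t _ = refl
lowerSum-vanish (suc (suc (suc M))) t e≡0
  rewrite lowerSum-vanish (suc (suc M)) t e≡0 | e≡0 M | *-zeroʳ ((sum t ∸ suc (suc M)) !) = *-zeroʳ M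

excess : List ℕ → List ℕ
excess = map (_∸ 2)

factProd : List ℕ → ℕ
factProd d = product (map _! d)

factProd-positive : ∀ d → 1 ≤ factProd d
factProd-positive []       = ≤-refl
factProd-positive (x ∷ xs) = *-mono-≤ (1≤n! x) (factProd-positive xs)

sum-excess-≤ : ∀ l → sum (excess l) ≤ sum l
sum-excess-≤ []       = z≤n
sum-excess-≤ (x ∷ xs) = +-mono-≤ (m∸n≤m x 2) (sum-excess-≤ xs)

strip-≥3 : ∀ l → All (3 ≤_) (strip l)
strip-≥3 []                       = []
strip-≥3 (0 ∷ xs)                 = strip-≥3 xs
strip-≥3 (1 ∷ xs)                 = strip-≥3 xs
strip-≥3 (2 ∷ xs)                 = strip-≥3 xs
strip-≥3 (suc (suc (suc z)) ∷ xs) = s≤s (s≤s (s≤s z≤n)) ∷ strip-≥3 xs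

sum-excess-strip : ∀ l → sum (excess (strip l)) ≡ sum (excess l)
sum-excess-strip []                       = refl
sum-excess-strip (0 ∷ xs)                 = sum-excess-strip xs
sum-excess-strip (1 ∷ xs)                 = sum-excess-strip xs
sum-excess-strip (2 ∷ xs)                 = sum-excess-strip xs
sum-excess-strip (suc (suc (suc z)) ∷ xs) = cong (suc z +_) (sum-excess-strip xs)

elemSym-excess-strip : ∀ m l → elemSym m (excess (strip l)) ≡ elemSym m (excess l)
elemSym-excess-strip m       []                       = refl
elemSym-excess-strip m       (0 ∷ xs)                 = trans (elemSym-excess-strip m xs) (sym (elemSym-0∷ m (excess xs)))
elemSym-excess-strip m       (1 ∷ xs)                 = trans (elemSym-excess-strip m xs) (sym (elemSym-0∷ m (excess xs)))
elemSym-excess-strip m       (2 ∷ xs)                 = trans (elemSym-excess-strip m xs) (sym (elemSym-0∷ m (excess xs)))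
elemSym-excess-strip zero    (suc (suc (suc z)) ∷ xs) = refl
elemSym-excess-strip (suc m) (suc (suc (suc z)) ∷ xs) =
  cong₂ (λ a b → suc z * a + b) (elemSym-excess-strip m xs) (elemSym-excess-strip (suc m) xs)

factProd-excess-strip : ∀ l → factProd (excess (strip l)) ≡ factProd (excess l)
factProd-excess-strip []                       = refl
factProd-excess-strip (0 ∷ xs)                 = trans (factProd-excess-strip xs) (sym (+-identityʳ _))
factProd-excess-strip (1 ∷ xs)                 = trans (factProd-excess-strip xs) (sym (+-identityʳ _))
factProd-excess-strip (2 ∷ xs)                 = trans (factProd-excess-strip xs) (sym (+-identityʳ _))
factProd-excess-strip (suc (suc (suc z)) ∷ xs) = cong (suc z ! *_) (factProd-excess-strip xs)

lowerSum-excess-strip : ∀ M l → lowerSum M (excess (strip l)) ≡ lowerSum M (excess l)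
lowerSum-excess-strip zero    l = refl
lowerSum-excess-strip (suc M) l =
  cong₂ _+_ (lowerSum-excess-strip M l)
            (cong₂ (λ S e → (M ∸ 2) * ((S ∸ M) ! * e)) (sum-excess-strip l) (elemSym-excess-strip M l))

decSum-excess-≤ : ∀ s → All (3 ≤_) s → ∀ (F G : List ℕ → ℕ) c →
  (∀ t → sum (excess t) < sum (excess s) → F (excess t) ≤ c * (factProd (excess t) * G t)) →
  decSum F (excess s) ≤ c * (factProd (excess s) * sum (map G (decs s)))
decSum-excess-≤ []       []                     F G c hyp = z≤n
decSum-excess-≤ (1 ∷ _)  (s≤s () ∷ _)           F G c hyp
decSum-excess-≤ (2 ∷ _)  (s≤s (s≤s ()) ∷ _)     F G c hyp
decSum-excess-≤ (suc (suc (suc z)) ∷ xs) (_ ∷ xs≥3) F G c hyp = begin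
  suc z * F (z ∷ excess xs) + decSum (λ t → F (suc z ∷ t)) (excess xs)
    ≤⟨ +-mono-≤ (*-monoʳ-≤ (suc z) (hyp (x ∸ 1 ∷ xs) ≤-refl))
                (decSum-excess-≤ xs xs≥3 (λ t → F (suc z ∷ t)) G′ (c * suc z !) hyp′) ⟩
  suc z * (c * (z ! * P * G (x ∸ 1 ∷ xs))) + c * suc z ! * (P * sum (map G′ (decs xs)))
    ≡⟨ cong (λ u → suc z * (c * (z ! * P * G (x ∸ 1 ∷ xs))) + c * suc z ! * (P * sum u)) (map-∘ (decs xs)) ⟩
  suc z * (c * (z ! * P * G (x ∸ 1 ∷ xs))) + c * suc z ! * (P * sum (map G (map (x ∷_) (decs xs))))
    ≡⟨ collect z (z !) c P _ _ ⟩
  c * (suc z ! * P * (G (x ∸ 1 ∷ xs) + sum (map G (map (x ∷_) (decs xs))))) ∎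
  where
  open ≤-Reasoning
  x  = suc (suc (suc z))
  P  = factProd (excess xs)
  G′ = λ t → G (x ∷ t)
  collect : ∀ z f c P g S → suc z * (c * (f * P * g)) + c * (suc z * f) * (P * S) ≡ c * (suc z * f * P * (g + S))
  collect = solve-∀
  hyp′ : ∀ t → sum (excess t) < sum (excess xs) → F (suc z ∷ excess t) ≤ c * suc z ! * (factProd (excess t) * G′ t)
  hyp′ t lt = ≤-trans (hyp (x ∷ t) (+-monoʳ-< (suc z) lt)) (≤-reflexive (reassoc c (suc z !) _ _))
    where
    reassoc : ∀ c f p g → c * (f * p * g) ≡ c * f * (p * g)
    reassoc = solve-∀

lowerSum-≤-wFuel-step : ∀ M f l →
  (∀ t → sum (excess t) ≤ f → lowerSum M (excess t) ≤ factProd (excess t) * wFuel f t) →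
  sum (excess (strip l)) ≤ suc f →
  lowerSum M (excess (strip l)) ≤ factProd (excess (strip l)) * wFuel (suc f) l
lowerSum-≤-wFuel-step M f l ih S≤1+f with strip l | strip-≥3 l
... | []            | _   = ≤-trans (≤-reflexive (lowerSum-vanish M [] (λ _ → refl))) z≤n
... | x ∷ []        | _   =
  ≤-trans (≤-reflexive (lowerSum-vanish M (x ∸ 2 ∷ []) (λ _ → trans (+-identityʳ _) (*-zeroʳ (x ∸ 2))))) z≤n
... | s@(_ ∷ _ ∷ _) | s≥3 = begin
  lowerSum M (excess s)
    ≤⟨ lowerSum-≤-decSum M (excess s) ⟩
  decSum (lowerSum M) (excess s) + (length (excess s) ∸ 2)
    ≤⟨ +-mono-≤ (decSum-excess-≤ s s≥3 (lowerSum M) (wFuel f) 1 ih′)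
                (≤-reflexive (cong (_∸ 2) (length-map (_∸ 2) s))) ⟩
  1 * (P * W) + b
    ≤⟨ +-mono-≤ (≤-reflexive (*-identityˡ (P * W))) b≤P*b ⟩
  P * W + P * b
    ≡⟨ *-distribˡ-+ P W b ⟨
  P * (W + b) ∎
  where
  open ≤-Reasoning
  P = factProd (excess s)
  W = sum (map (wFuel f) (decs s))
  b = length s ∸ 2
  b≤P*b : b ≤ P * b
  b≤P*b = ≤-trans (≤-reflexive (sym (*-identityˡ b))) (*-monoˡ-≤ b (factProd-positive (excess s)))
  ih′ : ∀ t → sum (excess t) < sum (excess s) → lowerSum M (excess t) ≤ 1 * (factProd (excess t) * wFuel f t)
  ih′ t lt = ≤-trans (ih t (≤-pred (≤-trans lt S≤1+f))) (≤-reflexive (sym (*-identityˡ _)))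

lowerSum-≤-wFuel : ∀ M f l → sum (excess l) ≤ f → lowerSum M (excess l) ≤ factProd (excess l) * wFuel f l
lowerSum-≤-wFuel M zero    l S≤0   =
  ≤-trans (≤-reflexive (lowerSum-vanish M (excess l) (λ m → elemSym-vanish (2 + m) (excess l) (s≤s (≤-trans S≤0 z≤n)))))
          z≤n
lowerSum-≤-wFuel M (suc f) l S≤1+f =
  subst₂ (λ L P → L ≤ P * wFuel (suc f) l) (lowerSum-excess-strip M l) (factProd-excess-strip l)
         (lowerSum-≤-wFuel-step M f l (lowerSum-≤-wFuel M f) (≤-trans (≤-reflexive (sum-excess-strip l)) S≤1+f))

lowerSum-≤-w : ∀ M l → lowerSum M (excess l) ≤ factProd (excess l) * w l
lowerSum-≤-w M l = lowerSum-≤-wFuel M (sum l) l (sum-excess-≤ l)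

[m*n]^k≡m^k*n^k : ∀ m n k → (m * n) ^ k ≡ m ^ k * n ^ k
[m*n]^k≡m^k*n^k m n zero    = refl
[m*n]^k≡m^k*n^k m n (suc k) = trans (cong (m * n *_) ([m*n]^k≡m^k*n^k m n k)) (interchange m n _ _)
  where
  interchange : ∀ a b c d → a * b * (c * d) ≡ a * c * (b * d)
  interchange = solve-∀

n!≡nP′k*[n∸k]! : ∀ {n k} → k ≤ n → n ! ≡ (n P′ k) * (n ∸ k) !
n!≡nP′k*[n∸k]! {n} {k} k≤n = begin
  n !                           ≡⟨ m/n*n≡m (m≤n⇒m!∣n! (m∸n≤m n k)) ⟨
  n ! / (n ∸ k) ! * (n ∸ k) !   ≡⟨ cong (_* (n ∸ k) !) (nP′k≡n!/[n∸k]! k≤n) ⟨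
  (n P′ k) * (n ∸ k) !          ∎
  where
  open ≡-Reasoning
  instance _ = (n ∸ k) !≢0

nP′k≤n^k : ∀ n k → n P′ k ≤ n ^ k
nP′k≤n^k n zero    = ≤-refl
nP′k≤n^k n (suc k) = *-mono-≤ (m∸n≤m n k) (nP′k≤n^k n k)

nP′k≡0 : ∀ {n k} → n < k → n P′ k ≡ 0
nP′k≡0 {n} {suc k} (s≤s n≤k) = cong (_* (n P′ k)) (m≤n⇒m∸n≡0 n≤k)

sum-replicate : ∀ r n → sum (replicate r n) ≡ r * n
sum-replicate zero    n = refl
sum-replicate (suc r) n = cong (n +_) (sum-replicate r n)

factProd-replicate : ∀ r n → factProd (replicate r n) ≡ (n !) ^ r
factProd-replicate zero    n = refl
factProd-replicate (suc r) n = cong (n ! *_) (factProd-replicate r n)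

elemSym-replicate : ∀ n r m → m ! * elemSym m (replicate r n) ≡ n ^ m * (r P′ m)
elemSym-replicate n r       zero    = refl
elemSym-replicate n zero    (suc m) =
  trans (*-zeroʳ (suc m !)) (sym (trans (cong (n ^ suc m *_) (nP′k≡0 {0} {suc m} (s≤s z≤n))) (*-zeroʳ (n ^ suc m))))
elemSym-replicate n (suc r) (suc m) = begin
  suc m ! * (n * elemSym m R + elemSym (suc m) R)
    ≡⟨ expand (suc m) (m !) n (elemSym m R) (elemSym (suc m) R) ⟩
  suc m * n * (m ! * elemSym m R) + suc m ! * elemSym (suc m) R
    ≡⟨ cong₂ (λ a b → suc m * n * a + b) (elemSym-replicate n r m) (elemSym-replicate n r (suc m)) ⟩
  suc m * n * (n ^ m * (r P′ m)) + n ^ suc m * ((r ∸ m) * (r P′ m))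
    ≡⟨ collect (suc m) (r ∸ m) n (n ^ m) (r P′ m) ⟩
  n ^ suc m * ((suc m + (r ∸ m)) * (r P′ m))
    ≡⟨ cong (n ^ suc m *_) count ⟩
  n ^ suc m * (suc r * (r P′ m))
    ≡⟨ cong (n ^ suc m *_) (nP′k≡n[n∸1P′k∸1] (suc r) (suc m)) ⟨
  n ^ suc m * (suc r P′ suc m) ∎
  where
  open ≡-Reasoning
  R = replicate r n
  expand : ∀ a f n e e′ → a * f * (n * e + e′) ≡ a * n * (f * e) + a * f * e′
  expand = solve-∀
  collect : ∀ a b n N F → a * n * (N * F) + n * N * (b * F) ≡ n * N * ((a + b) * F)
  collect = solve-∀
  count : (suc m + (r ∸ m)) * (r P′ m) ≡ suc r * (r P′ m)
  count with ≤-<-connex m r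
  ... | inj₁ m≤r = cong (λ n → suc n * (r P′ m)) (m+[n∸m]≡n m≤r)
  ... | inj₂ r<m rewrite nP′k≡0 r<m = trans (*-zeroʳ (suc m + (r ∸ m))) (sym (*-zeroʳ (suc r)))

-- Bernoulli-type inequality rᵐ ≤ r P′ m + m² rᵐ⁻¹, multiplied by r to stay in ℕ.
bernoulli-P′ : ∀ r m → m ≤ r → r * r ^ m ≤ r * (r P′ m) + m * m * r ^ m
bernoulli-P′ r zero    _   = m≤m+n _ _
bernoulli-P′ r (suc m) m<r = begin
  r * (r * p)
    ≡⟨ cong (_* (r * p)) (m+[n∸m]≡n (<⇒≤ m<r)) ⟨
  (m + t) * (r * p)
    ≡⟨ *-distribʳ-+ (r * p) m t ⟩
  m * (r * p) + t * (r * p)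
    ≤⟨ +-monoʳ-≤ (m * (r * p)) (*-monoʳ-≤ t (bernoulli-P′ r m (<⇒≤ m<r))) ⟩
  m * (r * p) + t * (r * F + m * m * p)
    ≡⟨ cong (m * (r * p) +_) (*-distribˡ-+ t (r * F) (m * m * p)) ⟩
  m * (r * p) + (t * (r * F) + t * (m * m * p))
    ≤⟨ +-monoʳ-≤ (m * (r * p)) (+-monoʳ-≤ (t * (r * F)) (*-monoˡ-≤ (m * m * p) (m∸n≤m r m))) ⟩
  m * (r * p) + (t * (r * F) + r * (m * m * p))
    ≡⟨ regroup m r p t F ⟩
  r * (t * F) + (m + m * m) * (r * p)
    ≤⟨ +-monoʳ-≤ (r * (t * F)) (*-monoˡ-≤ (r * p) (m≤m+n (m + m * m) (suc m))) ⟩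
  r * (t * F) + (m + m * m + suc m) * (r * p)
    ≡⟨ cong (λ a → r * (t * F) + a * (r * p)) (square m) ⟩
  r * (t * F) + suc m * suc m * (r * p) ∎
  where
  open ≤-Reasoning
  p = r ^ m
  t = r ∸ m
  F = r P′ m
  regroup : ∀ m r p t F → m * (r * p) + (t * (r * F) + r * (m * m * p)) ≡ r * (t * F) + (m + m * m) * (r * p)
  regroup = solve-∀
  square : ∀ m → m + m * m + suc m ≡ suc m * suc m
  square = solve-∀

n^k≤2*nP′k : ∀ n k → 2 * (k * k) ≤ n → k ≤ n → n ^ k ≤ 2 * (n P′ k)
n^k≤2*nP′k zero        zero _     _   = s≤s z≤n
n^k≤2*nP′k n@(suc _) k 2k²≤n k≤n = *-cancelˡ-≤ n (begin
  n * n ^ k           ≤⟨ +-cancelʳ-≤ (n * n ^ k) (n * n ^ k) (2 * (n * F)) doubled ⟩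
  2 * (n * F)         ≡⟨ swap 2 n F ⟩
  n * (2 * F)         ∎)
  where
  open ≤-Reasoning
  F = n P′ k
  swap : ∀ a b c → a * (b * c) ≡ b * (a * c)
  swap = solve-∀
  distrib : ∀ x y z p → 2 * (x * y + z * z * p) ≡ 2 * (x * y) + 2 * (z * z) * p
  distrib = solve-∀
  doubled : n * n ^ k + n * n ^ k ≤ 2 * (n * F) + n * n ^ k
  doubled = begin
    n * n ^ k + n * n ^ k            ≡⟨ cong (n * n ^ k +_) (+-identityʳ (n * n ^ k)) ⟨
    2 * (n * n ^ k)                  ≤⟨ *-monoʳ-≤ 2 (bernoulli-P′ n k k≤n) ⟩
    2 * (n * F + k * k * n ^ k)      ≡⟨ distrib n F k (n ^ k) ⟩
    2 * (n * F) + 2 * (k * k) * n ^ k ≤⟨ +-monoʳ-≤ (2 * (n * F)) (*-monoˡ-≤ (n ^ k) 2k²≤n) ⟩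
    2 * (n * F) + n * n ^ k          ∎

[r*n]!≤2*m!*term : ∀ r n m → 1 ≤ n → 2 * (m * m) ≤ r → m ≤ r → (r * n) ! ≤ 2 * (m ! * term m (replicate r n))
[r*n]!≤2*m!*term r n@(suc _) m _ 2m²≤r m≤r = begin
  (r * n) !                                 ≡⟨ n!≡nP′k*[n∸k]! (≤-trans m≤r (m≤m*n r n)) ⟩
  ((r * n) P′ m) * X                        ≤⟨ *-monoˡ-≤ X (nP′k≤n^k (r * n) m) ⟩
  (r * n) ^ m * X                           ≡⟨ cong (_* X) ([m*n]^k≡m^k*n^k r n m) ⟩
  r ^ m * n ^ m * X                         ≤⟨ *-monoˡ-≤ X (*-monoˡ-≤ (n ^ m) (n^k≤2*nP′k r m 2m²≤r m≤r)) ⟩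
  2 * (r P′ m) * n ^ m * X                  ≡⟨ regroup (r P′ m) (n ^ m) X ⟩
  2 * (X * (n ^ m * (r P′ m)))              ≡⟨ cong (λ u → 2 * (X * u)) (elemSym-replicate n r m) ⟨
  2 * (X * (m ! * elemSym m R))             ≡⟨ cong (2 *_) (swap X (m !) (elemSym m R)) ⟩
  2 * (m ! * (X * elemSym m R))             ≡⟨ cong (λ S → 2 * (m ! * ((S ∸ m) ! * elemSym m R))) (sum-replicate r n) ⟨
  2 * (m ! * term m R)                      ∎
  where
  open ≤-Reasoning
  R = replicate r n
  X = (r * n ∸ m) !
  regroup : ∀ f a b → 2 * f * a * b ≡ 2 * (b * (a * f))
  regroup = solve-∀
  swap : ∀ a b c → a * (b * c) ≡ b * (a * c)
  swap = solve-∀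

-- weightSum M = M! · Σ_{m ≤ M} (m ∸ 2)/m!; the series Σₘ (m ∸ 2)/m! sums to 3 − e.
weightSum : ℕ → ℕ
weightSum zero    = 0
weightSum (suc j) = suc j * weightSum j + (suc j ∸ 2)

weightSum+eS : ∀ j → 1 ≤ j → weightSum j + eS j + 1 ≡ 3 * j !
weightSum+eS (suc zero)    _ = refl
weightSum+eS (suc (suc i)) _ = begin
  suc (suc i) * weightSum (suc i) + i + (suc (suc i) * eS (suc i) + 1) + 1
    ≡⟨ factor i (weightSum (suc i)) (eS (suc i)) ⟩
  suc (suc i) * (weightSum (suc i) + eS (suc i) + 1)
    ≡⟨ cong (suc (suc i) *_) (weightSum+eS (suc i) (s≤s z≤n)) ⟩
  suc (suc i) * (3 * suc i !)
    ≡⟨ swap (suc (suc i)) (suc i !) ⟩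
  3 * suc (suc i) ! ∎
  where
  open ≡-Reasoning
  factor : ∀ i G E → suc (suc i) * G + i + (suc (suc i) * E + 1) + 1 ≡ suc (suc i) * (G + E + 1)
  factor = solve-∀
  swap : ∀ a f → a * (3 * f) ≡ 3 * (a * f)
  swap = solve-∀

-- Dividing by eDen a · (a + 3)!, this says Σ_{i ≤ a+3} 1/i! + 1/(a+3)! ≤ eNum a / eDen a:
-- the tail term 1/(a · a!) absorbs three more terms of the series and 1/(a+3)!.
weightSum-bound : ∀ a → 3 * eDen a * (3 + a) ! ≤ eNum a * (3 + a) ! + eDen a * weightSum (3 + a)
weightSum-bound a = begin
  3 * D * K                              ≡⟨ swap D K ⟩
  D * (3 * K)                            ≡⟨ cong (D *_) (weightSum+eS (3 + a) (s≤s z≤n)) ⟨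
  D * (G + eS (3 + a) + 1)               ≡⟨ distrib D G (eS (3 + a)) ⟩
  D * (eS (3 + a) + 1) + D * G           ≤⟨ +-monoˡ-≤ (D * G) (m≤m+n _ (6 * a !)) ⟩
  D * (eS (3 + a) + 1) + 6 * a ! + D * G ≡⟨ cong (_+ D * G) (unfold a (eS a) (a !)) ⟩
  eNum a * K + D * G                     ∎
  where
  open ≤-Reasoning
  D = eDen a
  K = (3 + a) !
  G = weightSum (3 + a)
  swap : ∀ d k → 3 * d * k ≡ d * (3 * k)
  swap = solve-∀
  distrib : ∀ d g e → d * (g + e + 1) ≡ d * (e + 1) + d * g
  distrib = solve-∀
  unfold : ∀ a E F → a * F * ((3 + a) * ((2 + a) * ((1 + a) * E + 1) + 1) + 1 + 1) + 6 * F
                   ≡ (a * E + 1) * ((3 + a) * ((2 + a) * ((1 + a) * F)))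
  unfold = solve-∀

lowerSum-≥-weightSum : ∀ t X M → (∀ m → m ≤ M → X ≤ 2 * (m ! * term m t)) →
  X * weightSum M ≤ 2 * (M ! * lowerSum (suc M) t)
lowerSum-≥-weightSum t X zero    _      = ≤-trans (≤-reflexive (*-zeroʳ X)) z≤n
lowerSum-≥-weightSum t X (suc j) X≤term = begin
  X * (suc j * weightSum j + (suc j ∸ 2))
    ≡⟨ distrib X (suc j) (weightSum j) (suc j ∸ 2) ⟩
  suc j * (X * weightSum j) + (suc j ∸ 2) * X
    ≤⟨ +-mono-≤ (*-monoʳ-≤ (suc j) (lowerSum-≥-weightSum t X j (λ m m≤j → X≤term m (m≤n⇒m≤1+n m≤j))))
                (*-monoʳ-≤ (suc j ∸ 2) (X≤term (suc j) ≤-refl)) ⟩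
  suc j * (2 * (j ! * lowerSum (suc j) t)) + (suc j ∸ 2) * (2 * (suc j ! * term (suc j) t))
    ≡⟨ collect (suc j) (j !) (lowerSum (suc j) t) (suc j ∸ 2) (term (suc j) t) ⟩
  2 * (suc j ! * (lowerSum (suc j) t + (suc j ∸ 2) * term (suc j) t)) ∎
  where
  open ≤-Reasoning
  distrib : ∀ X a g c → X * (a * g + c) ≡ a * (X * g) + c * X
  distrib = solve-∀
  collect : ∀ a f B c T → a * (2 * (f * B)) + c * (2 * (a * f * T)) ≡ 2 * (a * f * (B + c * T))
  collect = solve-∀

wDiag-≥-lowerSum : ∀ M r k → lowerSum M (replicate r (k ∸ 2)) ≤ wDiag r k * ((k ∸ 2) !) ^ r
wDiag-≥-lowerSum M r k = begin
  lowerSum M (replicate r (k ∸ 2))                   ≡⟨ cong (lowerSum M) (map-replicate (_∸ 2) r k) ⟨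
  lowerSum M (excess (replicate r k))                ≤⟨ lowerSum-≤-w M (replicate r k) ⟩
  factProd (excess (replicate r k)) * wDiag r k      ≡⟨ cong (λ d → factProd d * wDiag r k) (map-replicate (_∸ 2) r k) ⟩
  factProd (replicate r (k ∸ 2)) * wDiag r k         ≡⟨ cong (_* wDiag r k) (factProd-replicate r (k ∸ 2)) ⟩
  ((k ∸ 2) !) ^ r * wDiag r k                        ≡⟨ *-comm (((k ∸ 2) !) ^ r) (wDiag r k) ⟩
  wDiag r k * ((k ∸ 2) !) ^ r                        ∎
  where open ≤-Reasoning

wDiag-bound : ∀ a r k → 3 ≤ k → 2 * ((3 + a) * (3 + a)) ≤ r → 3 + a ≤ r →
  3 * eDen a * (r * (k ∸ 2)) ! ≤ eNum a * (r * (k ∸ 2)) ! + 2 * eDen a * (wDiag r k * ((k ∸ 2) !) ^ r)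
wDiag-bound a r k 3≤k 2M²≤r M≤r = *-cancelʳ-≤ _ _ K {{(3 + a) !≢0}} (begin
  3 * D * X * K                  ≡⟨ swap D X K ⟩
  X * (3 * D * K)                ≤⟨ *-monoʳ-≤ X (weightSum-bound a) ⟩
  X * (N * K + D * weightSum M)  ≡⟨ distrib X N K D (weightSum M) ⟩
  N * X * K + D * (X * weightSum M)
    ≤⟨ +-monoʳ-≤ (N * X * K) (*-monoʳ-≤ D (lowerSum-≥-weightSum (replicate r n) X M X≤term)) ⟩
  N * X * K + D * (2 * (K * lowerSum (suc M) (replicate r n)))
    ≤⟨ +-monoʳ-≤ (N * X * K) (*-monoʳ-≤ D (*-monoʳ-≤ 2 (*-monoʳ-≤ K (wDiag-≥-lowerSum (suc M) r k)))) ⟩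
  N * X * K + D * (2 * (K * Z))  ≡⟨ collect N X K D Z ⟩
  (N * X + 2 * D * Z) * K        ∎)
  where
  open ≤-Reasoning
  M = 3 + a
  K = M !
  n = k ∸ 2
  X = (r * n) !
  D = eDen a
  N = eNum a
  Z = wDiag r k * (n !) ^ r
  X≤term : ∀ m → m ≤ M → X ≤ 2 * (m ! * term m (replicate r n))
  X≤term m m≤M = [r*n]!≤2*m!*term r n m (∸-monoˡ-≤ 2 3≤k)
                   (≤-trans (*-monoʳ-≤ 2 (*-mono-≤ m≤M m≤M)) 2M²≤r) (≤-trans m≤M M≤r)
  swap : ∀ d x k → 3 * d * x * k ≡ x * (3 * d * k)
  swap = solve-∀
  distrib : ∀ x n k d g → x * (n * k + d * g) ≡ n * x * k + d * (x * g)
  distrib = solve-∀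
  collect : ∀ n x k d z → n * x * k + d * (2 * (k * z)) ≡ (n * x + 2 * d * z) * k
  collect = solve-∀

ℕ→ℚ≡mkℚ : ∀ n → ℕ→ℚ n ≡ mkℚ (ℤ.+ n) 0 (coprime-sym (1-coprimeTo n))
ℕ→ℚ≡mkℚ n = ℚₚ.normalize-coprime (coprime-sym (1-coprimeTo n))

ℕ→ℚ-* : ∀ m n → ℕ→ℚ (m * n) ≡ ℕ→ℚ m ℚ.* ℕ→ℚ n
ℕ→ℚ-* m n = trans (cong (ℚ._/ 1) (ℤₚ.pos-* m n)) (cong₂ ℚ._*_ (sym (ℕ→ℚ≡mkℚ m)) (sym (ℕ→ℚ≡mkℚ n)))

ℕ→ℚ-+ : ∀ m n → ℕ→ℚ (m + n) ≡ ℕ→ℚ m ℚ.+ ℕ→ℚ n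
ℕ→ℚ-+ m n = trans (cong (ℚ._/ 1) numerator) (cong₂ ℚ._+_ (sym (ℕ→ℚ≡mkℚ m)) (sym (ℕ→ℚ≡mkℚ n)))
  where
  numerator : ℤ.+ (m + n) ≡ ℤ.+ m ℤ.* ℤ.+ 1 ℤ.+ ℤ.+ n ℤ.* ℤ.+ 1
  numerator rewrite ℤₚ.*-identityʳ (ℤ.+ m) | ℤₚ.*-identityʳ (ℤ.+ n) = ℤₚ.pos-+ m n

ℕ→ℚ-mono-≤ : ∀ {m n} → m ≤ n → ℕ→ℚ m ℚ.≤ ℕ→ℚ n
ℕ→ℚ-mono-≤ {m} {n} m≤n rewrite ℕ→ℚ≡mkℚ m | ℕ→ℚ≡mkℚ n =
  ℚ.*≤* (subst₂ ℤ._≤_ (sym (ℤₚ.*-identityʳ (ℤ.+ m))) (sym (ℤₚ.*-identityʳ (ℤ.+ n))) (ℤ.+≤+ m≤n))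

ℕ→ℚ-nonNeg : ∀ n → ℚ.NonNegative (ℕ→ℚ n)
ℕ→ℚ-nonNeg n rewrite ℕ→ℚ≡mkℚ n = _

ℕ→ℚ-pos : ∀ n → 1 ≤ n → ℚ.Positive (ℕ→ℚ n)
ℕ→ℚ-pos (suc n) _ rewrite ℕ→ℚ≡mkℚ (suc n) = _

p≤q+r⇒p-q≤r : ∀ p q r → p ℚ.≤ q ℚ.+ r → p ℚ.- q ℚ.≤ r
p≤q+r⇒p-q≤r p q r p≤q+r = ℚₚ.≤-trans (ℚₚ.+-monoˡ-≤ (ℚ.- q) p≤q+r) (ℚₚ.≤-reflexive cancel)
  where
  open +-*-Solver
  cancel : (q ℚ.+ r) ℚ.- q ≡ r
  cancel = solve 2 (λ q r → (q :+ r) :- q := r) refl q r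

q*X≤Z-fromℕ : ∀ q D N X Z → 1 ≤ D →
  (ℕ→ℚ 2 ℚ.* q) ℚ.* ℕ→ℚ D ℚ.≤ ℕ→ℚ (3 * D) ℚ.- ℕ→ℚ N →
  3 * D * X ≤ N * X + 2 * D * Z →
  q ℚ.* ℕ→ℚ X ℚ.≤ ℕ→ℚ Z
q*X≤Z-fromℕ q D N X Z 1≤D q≤ nat-bound = ℚₚ.*-cancelˡ-≤-pos (c (2 * D)) {{ℕ→ℚ-pos (2 * D) 1≤2D}} (begin
  c (2 * D) ℚ.* (q ℚ.* c X)            ≡⟨ reassoc ⟩
  ((c 2 ℚ.* q) ℚ.* c D) ℚ.* c X        ≤⟨ ℚₚ.*-monoʳ-≤-nonNeg (c X) {{ℕ→ℚ-nonNeg X}} q≤ ⟩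
  (c (3 * D) ℚ.- c N) ℚ.* c X          ≡⟨ distrib ⟩
  c (3 * D * X) ℚ.- c (N * X)          ≤⟨ p≤q+r⇒p-q≤r _ _ _ (ℚₚ.≤-trans (ℕ→ℚ-mono-≤ nat-bound) (ℚₚ.≤-reflexive (ℕ→ℚ-+ (N * X) _))) ⟩
  c (2 * D * Z)                        ≡⟨ ℕ→ℚ-* (2 * D) Z ⟩
  c (2 * D) ℚ.* c Z                    ∎)
  where
  open ℚₚ.≤-Reasoning
  open +-*-Solver
  c = ℕ→ℚ
  1≤2D : 1 ≤ 2 * D
  1≤2D = *-mono-≤ {1} {2} (s≤s z≤n) 1≤D
  reassoc : c (2 * D) ℚ.* (q ℚ.* c X) ≡ ((c 2 ℚ.* q) ℚ.* c D) ℚ.* c X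
  reassoc rewrite ℕ→ℚ-* 2 D =
    solve 4 (λ a b q x → (a :* b) :* (q :* x) := ((a :* q) :* b) :* x) refl (c 2) (c D) q (c X)
  distrib : (c (3 * D) ℚ.- c N) ℚ.* c X ≡ c (3 * D * X) ℚ.- c (N * X)
  distrib rewrite ℕ→ℚ-* (3 * D) X | ℕ→ℚ-* N X =
    solve 3 (λ a b x → (a :- b) :* x := a :* x :- b :* x) refl (c (3 * D)) (c N) (c X)

theorem3p8 : (k : ℕ) → 4 ≤ k → (q : ℚ) → BelowConst q →
    Σ ℕ (λ R → (r : ℕ) → 2 ≤ r → R ≤ r →
      q ℚ.* ℕ→ℚ ((r * (k ∸ 2)) !) ℚ.≤ ℕ→ℚ (wDiag r k) ℚ.* ℕ→ℚ (((k ∸ 2) !) ^ r))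
theorem3p8 k 4≤k q (a , 1≤a , q≤) = 2 * (M * M) + M , bound
  where
  M = 3 + a
  bound : (r : ℕ) → 2 ≤ r → 2 * (M * M) + M ≤ r →
    q ℚ.* ℕ→ℚ ((r * (k ∸ 2)) !) ℚ.≤ ℕ→ℚ (wDiag r k) ℚ.* ℕ→ℚ (((k ∸ 2) !) ^ r)
  bound r _ R≤r =
    subst (q ℚ.* ℕ→ℚ ((r * (k ∸ 2)) !) ℚ.≤_) (ℕ→ℚ-* (wDiag r k) _)
      (q*X≤Z-fromℕ q (eDen a) (eNum a) _ _ (*-mono-≤ 1≤a (1≤n! a)) q≤
        (wDiag-bound a r k (≤-trans (n≤1+n 3) 4≤k) (≤-trans (m≤m+n _ M) R≤r) (≤-trans (m≤n+m M (2 * (M * M))) R≤r)))
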